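{- For each $v\in\mathcal{V}_4$, we have $\alpha(\theta(v))=\theta(\alpha(v))$.
   Context: Words: $E=\{a,b\}$, $E^*$ the monoid of finite words under concatenation, $\epsilon$ the empty word, $|w|$ the length; $u\le w$ means $u$ is a prefix of $w$, $u<w$ means $u\le w$, $u\ne w$. $\theta:E^*\to E^*$ is the monoid morphism with $\theta(a)=ab$, $\theta(b)=a$. $w_1=a$, $w_2=ab$, $w_{i+2}=w_{i+1}w_i$, $w_\infty=\lim w_i$; prefixes of $w_\infty$ are words $\le w_i$ for some $i$. Fibonacci numbers $F_{ -1}=0,F_0=1,F_{i+2}=F_{i+1}+F_i$. $\mathcal{F}=\{\epsilon,w_1,w_2,\dots\}$. For a prefix $v$ of $w_\infty$: $\iota(v)=v$ if $v\in\mathcal{F}$, else $w_i<v<w_{i+1}$ for some $i\ge3$ and $\iota(v)$ is the prefix of $w_\infty$ of length $|v|-2F_{i-2}$; $\alpha(v)=\lim_k\iota^k(v)$. For $\ell\ge1$, $\mathcal{V}_\ell=\{v\text{ prefix of }w_\infty: \alpha(v)\ge w_\ell\}$. -}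

module Defs where

open import Data.Nat using (ℕ; zero; suc; _+_; _*_; _∸_)
open import Data.Bool using (Bool; true; false; _∧_; _∨_; not; if_then_else_)
open import Data.List using (List; []; _∷_; _++_; length; take; concatMap)
open import Data.Maybe using (Maybe; just; nothing)
open import Data.Product using (Σ; ∃; _×_; _,_)
open import Relation.Binary.PropositionalEquality using (_≡_)
open import Function using (_∘_)

data E : Set where
  a b : E

Word : Set
Word = List E

_≼_ : Word → Word → Set
u ≼ v = Σ Word λ s → u ++ s ≡ v

θE : E → Word
θE a = a ∷ b ∷ []
θE b = a ∷ []

θ : Word → Word
θ = concatMap θE

-- Fibonacci words: w 1 = a, w 2 = ab, w (i+2) = w (i+1) w i.
-- (w 0 = b is an auxiliary value making the recursion work; it is never
--  used as an element of 𝓕 — only indices i ≥ 1 are used below.)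
w : ℕ → Word
w zero = b ∷ []
w (suc zero) = a ∷ []
w (suc (suc n)) = w (suc n) ++ w n

IsPrefW∞ : Word → Set
IsPrefW∞ v = Σ ℕ λ i → v ≼ w (suc i)

-- The prefix of w∞ of length n (w (n+1) has length F_n ≥ n+1 > n, and
-- every w i is a prefix of w (i+1), hence of w∞).
prefW∞ : ℕ → Word
prefW∞ n = take n (w (suc n))

-- Fibonacci numbers, F k = fibF k with F_{-1} = 0: we write F (k+1) := F_k.
-- i.e. Fm k = F_{k-1}.
Fm : ℕ → ℕ
Fm zero = 0
Fm (suc zero) = 1
Fm (suc (suc n)) = Fm (suc n) + Fm n

eqE : E → E → Bool
eqE a a = true
eqE b b = true
eqE a b = false
eqE b a = false

eqW : Word → Word → Bool
eqW [] [] = true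
eqW (x ∷ xs) (y ∷ ys) = eqE x y ∧ eqW xs ys
eqW _ _ = false

prefᵇ : Word → Word → Bool
prefᵇ [] _ = true
prefᵇ (x ∷ xs) [] = false
prefᵇ (x ∷ xs) (y ∷ ys) = eqE x y ∧ prefᵇ xs ys

sprefᵇ : Word → Word → Bool
sprefᵇ u v = prefᵇ u v ∧ not (eqW u v)

anyIdx : (ℕ → Bool) → ℕ → Bool
anyIdx p zero = false
anyIdx p (suc n) = p (suc n) ∨ anyIdx p n

findIdx : {A : Set} → (ℕ → Maybe A) → ℕ → Maybe A
findIdx f zero = nothing
findIdx f (suc n) with f (suc n)
... | just x = just x
... | nothing = findIdx f n

-- Membership in 𝓕 = {ε, w 1, w 2, …}.  If v = w i with i ≥ 1 then
-- |v| = F_{i-1} ≥ i, so searching i ∈ {1, …, |v|+1} is exhaustive.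
inFᵇ : Word → Bool
inFᵇ v = eqW v [] ∨ anyIdx (λ i → eqW v (w i)) (suc (length v))

-- The map ι on prefixes of w∞:
--   ι v = v                                if v ∈ 𝓕,
--   ι v = prefix of w∞ of length |v| - 2 F_{i-2}   if w i < v < w (i+1), i ≥ 3.
-- If w i < v then i ≤ |v|, so searching i ∈ {1,…,|v|+1} is exhaustive.
-- The last fallback (returning v) is never reached for prefixes of w∞.
ιstep : Word → ℕ → Maybe Word
ιstep v i with sprefᵇ (w i) v ∧ sprefᵇ v (w (suc i))
... | true  = just (prefW∞ (length v ∸ 2 * Fm (i ∸ 1)))
... | false = nothing

ι : Word → Word
ι v with inFᵇ v
... | true  = v
... | false with findIdx (ιstep v) (suc (length v))
...   | just u  = u
...   | nothing = v

iterate : {A : Set} → (A → A) → ℕ → A → A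
iterate f zero x = x
iterate f (suc k) x = f (iterate f k x)

-- α v = lim_k ι^k v.  Every step with ι v ≠ v strictly shortens v
-- (by 2 F_{i-2} ≥ 2), so the sequence ι^k v is constant from k = |v| on;
-- its limit is therefore ι^{|v|} v.
α : Word → Word
α v = iterate ι (length v) v

𝓥 : ℕ → Word → Set
𝓥 ℓ v = IsPrefW∞ v × (w ℓ ≼ α v)

-- Prefixes of w∞ are determined by their lengths, so ι, α and θ can be read on
-- lengths.  With L k = |w k|, ι fixes 0 and every L k and sends L (3 + j) + r to
-- L j + r when 0 < r < L (2 + j); θ sends the prefix of length n to the one of
-- length Θ n = n + (number of a's in it).  Since w k w (2 + k) and w (2 + k) w k
-- differ by one transposition of adjacent letters, Θ (L k + r) = L (k + 1) + Θ r
-- unless r + 1 = L (k + 1).  So Θ maps fixed points to fixed points and every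
-- ι-step L (3 + j) + r ↦ L j + r to the ι-step L (4 + j) + Θ r ↦ L (1 + j) + Θ r,
-- except the steps landing on L (2 + j) - 1; but the ι-orbit of L J - 1 ends at a
-- length ≤ 3, below |w 4|.  Hence for v ∈ 𝓥 4, θ carries the ι-orbit of v onto
-- the ι-orbit of θ v.

module Submission where

open import Defs
open import Data.Nat using (ℕ; zero; suc; _+_; _*_; _∸_; _≤_; _<_; z≤n; s≤s; _≟_)
open import Data.Nat.Properties
open import Data.Nat.Induction using (<-rec)
open import Data.Nat.Tactic.RingSolver using (solve-∀)
open import Data.Bool using (true; false; _∧_; _∨_; not)
open import Data.Bool.Properties using (∧-conicalˡ; ∧-conicalʳ; ∨-zeroʳ; ¬-not)
open import Data.List using ([]; _∷_; _++_; length; take; drop)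
open import Data.List.Properties
  using (length-++; length-take; ++-assoc; ++-identityʳ; concatMap-++; take++drop≡id)
open import Data.Maybe using (Maybe; just; nothing)
open import Data.Product using (∃-syntax; _×_; _,_)
open import Data.Sum using (inj₁; inj₂)
open import Relation.Nullary using (yes; no; contradiction)
open import Relation.Binary.PropositionalEquality
open import Function using (_∘_)

≼-refl : ∀ u → u ≼ u
≼-refl u = [] , ++-identityʳ u

≼-trans : ∀ {u v x} → u ≼ v → v ≼ x → u ≼ x
≼-trans {u} (s , refl) (t , refl) = s ++ t , sym (++-assoc u s t)

≼-length : ∀ {u v} → u ≼ v → length u ≤ length v
≼-length {u} (s , refl) = subst (length u ≤_) (sym (length-++ u)) (m≤m+n _ _)

take-length-≼ : ∀ {u x} → u ≼ x → take (length u) x ≡ u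
take-length-≼ {[]} _ = refl
take-length-≼ {c ∷ u} (s , refl) = cong (c ∷_) (take-length-≼ (s , refl))

take-≼ : ∀ {x y} n → x ≼ y → n ≤ length x → take n x ≡ take n y
take-≼ zero _ _ = refl
take-≼ {c ∷ x} (suc n) (s , refl) (s≤s n≤∣x∣) = cong (c ∷_) (take-≼ n (s , refl) n≤∣x∣)

take-≼-take : ∀ {m n} (x : Word) → m ≤ n → take m x ≼ take n x
take-≼-take {zero} x _ = take _ x , refl
take-≼-take {suc m} {suc n} [] _ = [] , refl
take-≼-take {suc m} {suc n} (c ∷ x) (s≤s m≤n) with take-≼-take x m≤n
... | s , eq = s , cong (c ∷_) eq

≼-++ˡ : ∀ u {v v′} → v ≼ v′ → (u ++ v) ≼ (u ++ v′)
≼-++ˡ u {v} (s , refl) = s , ++-assoc u v s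

take-length-++ : ∀ (u : Word) m z → take (length u + m) (u ++ z) ≡ u ++ take m z
take-length-++ [] m z = refl
take-length-++ (c ∷ u) m z = cong (c ∷_) (take-length-++ u m z)

L : ℕ → ℕ
L k = Fm (suc k)

L-pos : ∀ k → 1 ≤ L k
L-pos zero = s≤s z≤n
L-pos (suc zero) = s≤s z≤n
L-pos (suc (suc k)) = ≤-trans (L-pos (suc k)) (m≤m+n _ _)

L-≤-suc : ∀ k → L k ≤ L (suc k)
L-≤-suc zero = ≤-refl
L-≤-suc (suc k) = m≤m+n _ _

L-<-suc : ∀ k → L (suc k) < L (2 + k)
L-<-suc k = m<m+n (L (suc k)) (L-pos k)

L-mono-≤ : ∀ {j k} → j ≤ k → L j ≤ L k
L-mono-≤ {k = zero} z≤n = ≤-refl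
L-mono-≤ {k = suc k} j≤1+k with m≤n⇒m<n∨m≡n j≤1+k
... | inj₁ (s≤s j≤k) = ≤-trans (L-mono-≤ j≤k) (L-≤-suc k)
... | inj₂ refl = ≤-refl

n≤L[n] : ∀ n → n ≤ L n
n≤L[n] zero = z≤n
n≤L[n] (suc zero) = ≤-refl
n≤L[n] (suc (suc n)) = ≤-trans (s≤s (n≤L[n] (suc n))) (L-<-suc n)

n≤L[1+n] : ∀ n → n ≤ L (suc n)
n≤L[1+n] n = ≤-trans (n≤1+n n) (n≤L[n] (suc n))

L-≥2 : ∀ k → 2 ≤ L (2 + k)
L-≥2 k = L-mono-≤ {2} {2 + k} (s≤s (s≤s z≤n))

L∸1<L : ∀ k → L k ∸ 1 < L k
L∸1<L k = ∸-monoʳ-< (s≤s z≤n) (L-pos k)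

0<L∸1 : ∀ k → 0 < L (2 + k) ∸ 1
0<L∸1 k = m<n⇒0<n∸m (L-≥2 k)

length-w : ∀ k → length (w k) ≡ L k
length-w zero = refl
length-w (suc zero) = refl
length-w (suc (suc k)) = trans (length-++ (w (suc k))) (cong₂ _+_ (length-w (suc k)) (length-w k))

w-≼-suc : ∀ k → w (suc k) ≼ w (2 + k)
w-≼-suc zero = b ∷ [] , refl
w-≼-suc (suc k) = w (suc k) , refl

w-mono : ∀ {j k} → j ≤ k → w (suc j) ≼ w (suc k)
w-mono {k = zero} z≤n = ≼-refl _
w-mono {k = suc k} j≤1+k with m≤n⇒m<n∨m≡n j≤1+k
... | inj₁ (s≤s j≤k) = ≼-trans (w-mono j≤k) (w-≼-suc k)
... | inj₂ refl = ≼-refl _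

θ-++ : ∀ u v → θ (u ++ v) ≡ θ u ++ θ v
θ-++ = concatMap-++ θE

θ-≼ : ∀ {u v} → u ≼ v → θ u ≼ θ v
θ-≼ {u} (s , refl) = θ s , sym (θ-++ u s)

θ-w : ∀ k → θ (w k) ≡ w (suc k)
θ-w zero = refl
θ-w (suc zero) = refl
θ-w (suc (suc k)) = trans (θ-++ (w (suc k)) (w k)) (cong₂ _++_ (θ-w (suc k)) (θ-w k))

w-swap : ∀ k → ∃[ x ] ∃[ c ] ∃[ d ]
  (w k ++ w (suc k) ≡ x ++ c ∷ d ∷ []) × (w (suc k) ++ w k ≡ x ++ d ∷ c ∷ [])
w-swap zero = [] , b , a , refl , refl
w-swap (suc k) with w-swap k
... | x , c , d , w·w′ , w′·w = w (suc k) ++ x , d , c ,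
  trans (cong (w (suc k) ++_) w′·w) (sym (++-assoc (w (suc k)) x _)) ,
  trans (++-assoc (w (suc k)) (w k) (w (suc k)))
    (trans (cong (w (suc k) ++_) w·w′) (sym (++-assoc (w (suc k)) x _)))

prefW∞-take : ∀ {n} j → n ≤ L (suc j) → prefW∞ n ≡ take n (w (suc j))
prefW∞-take {n} j n≤L with ≤-total n j
... | inj₁ n≤j = take-≼ n (w-mono n≤j) (subst (n ≤_) (sym (length-w (suc n))) (n≤L[1+n] n))
... | inj₂ j≤n = sym (take-≼ n (w-mono j≤n) (subst (n ≤_) (sym (length-w (suc j))) n≤L))

length-prefW∞ : ∀ n → length (prefW∞ n) ≡ n
length-prefW∞ n = trans (length-take n (w (suc n)))
  (m≤n⇒m⊓n≡m (subst (n ≤_) (sym (length-w (suc n))) (n≤L[1+n] n)))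

prefW∞-isPref : ∀ n → IsPrefW∞ (prefW∞ n)
prefW∞-isPref n = n , drop n (w (suc n)) , take++drop≡id n (w (suc n))

isPref⇒≡prefW∞ : ∀ {u} → IsPrefW∞ u → u ≡ prefW∞ (length u)
isPref⇒≡prefW∞ {u} (j , u≼w) = begin
  u                           ≡⟨ take-length-≼ u≼w ⟨
  take (length u) (w (suc j)) ≡⟨ prefW∞-take j (subst (length u ≤_) (length-w (suc j)) (≼-length u≼w)) ⟨
  prefW∞ (length u)           ∎
  where open ≡-Reasoning

prefW∞-injective : ∀ {m n} → prefW∞ m ≡ prefW∞ n → m ≡ n
prefW∞-injective {m} {n} eq = trans (sym (length-prefW∞ m)) (trans (cong length eq) (length-prefW∞ n))

prefW∞-mono : ∀ {m n} → m ≤ n → prefW∞ m ≼ prefW∞ n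
prefW∞-mono {m} {n} m≤n = subst (_≼ prefW∞ n) (sym (prefW∞-take n (≤-trans m≤n (n≤L[1+n] n))))
  (take-≼-take (w (suc n)) m≤n)

prefW∞-L : ∀ i → prefW∞ (L (suc i)) ≡ w (suc i)
prefW∞-L i = sym (trans (isPref⇒≡prefW∞ (i , ≼-refl _)) (cong prefW∞ (length-w (suc i))))

θ-isPref : ∀ {u} → IsPrefW∞ u → IsPrefW∞ (θ u)
θ-isPref {u} (j , u≼w) = suc j , subst (θ u ≼_) (θ-w (suc j)) (θ-≼ u≼w)

prefW∞-take-≼ : ∀ {u n} → IsPrefW∞ u → n ≤ length u → prefW∞ n ≡ take n u
prefW∞-take-≼ {u} {n} (j , u≼w) n≤∣u∣ = trans
  (prefW∞-take j (≤-trans n≤∣u∣ (subst (length u ≤_) (length-w (suc j)) (≼-length u≼w))))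
  (sym (take-≼ n u≼w n≤∣u∣))

eqE-sound : ∀ x y → eqE x y ≡ true → x ≡ y
eqE-sound a a _ = refl
eqE-sound b b _ = refl

eqE-refl : ∀ x → eqE x x ≡ true
eqE-refl a = refl
eqE-refl b = refl

eqW-sound : ∀ u v → eqW u v ≡ true → u ≡ v
eqW-sound [] [] _ = refl
eqW-sound (x ∷ u) (y ∷ v) eq =
  cong₂ _∷_ (eqE-sound x y (∧-conicalˡ _ _ eq)) (eqW-sound u v (∧-conicalʳ (eqE x y) _ eq))

eqW-refl : ∀ u → eqW u u ≡ true
eqW-refl [] = refl
eqW-refl (x ∷ u) rewrite eqE-refl x = eqW-refl u

eqW-≢ : ∀ u v → u ≢ v → eqW u v ≡ false
eqW-≢ u v u≢v = ¬-not (u≢v ∘ eqW-sound u v)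

prefᵇ-sound : ∀ u v → prefᵇ u v ≡ true → u ≼ v
prefᵇ-sound [] v _ = v , refl
prefᵇ-sound (x ∷ u) (y ∷ v) eq with prefᵇ-sound u v (∧-conicalʳ (eqE x y) _ eq)
... | s , refl = s , cong (_∷ u ++ s) (eqE-sound x y (∧-conicalˡ _ _ eq))

prefᵇ-complete : ∀ {u v} → u ≼ v → prefᵇ u v ≡ true
prefᵇ-complete {[]} _ = refl
prefᵇ-complete {x ∷ u} (s , refl) rewrite eqE-refl x = prefᵇ-complete {u} (s , refl)

sprefᵇ-complete : ∀ {u v} → u ≼ v → length u < length v → sprefᵇ u v ≡ true
sprefᵇ-complete {u} {v} u≼v u<v =
  cong₂ (λ p q → p ∧ not q) (prefᵇ-complete u≼v) (eqW-≢ u v (λ u≡v → <-irrefl (cong length u≡v) u<v))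

anyIdx-true : ∀ p {N i} → 1 ≤ i → i ≤ N → p i ≡ true → anyIdx p N ≡ true
anyIdx-true p {zero} (s≤s _) ()
anyIdx-true p {suc N} {i} 1≤i i≤1+N pi with m≤n⇒m<n∨m≡n i≤1+N
... | inj₁ (s≤s i≤N) = trans (cong (p (suc N) ∨_) (anyIdx-true p 1≤i i≤N pi)) (∨-zeroʳ _)
... | inj₂ refl rewrite pi = refl

anyIdx-false : ∀ p N → (∀ i → p (suc i) ≡ false) → anyIdx p N ≡ false
anyIdx-false p zero _ = refl
anyIdx-false p (suc N) p≡false rewrite p≡false N = anyIdx-false p N p≡false

findIdx-top : ∀ {A : Set} (f : ℕ → Maybe A) {N i x} → 1 ≤ i → i ≤ N → f i ≡ just x →
  (∀ k → i < k → k ≤ N → f k ≡ nothing) → findIdx f N ≡ just x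
findIdx-top f {zero} (s≤s _) ()
findIdx-top f {suc N} {i} 1≤i i≤1+N fi above with m≤n⇒m<n∨m≡n i≤1+N
... | inj₁ (s≤s i≤N) rewrite above (suc N) (s≤s i≤N) ≤-refl =
  findIdx-top f 1≤i i≤N fi (λ k i<k k≤N → above k i<k (m≤n⇒m≤1+n k≤N))
... | inj₂ refl rewrite fi = refl

inFᵇ-w : ∀ i → inFᵇ (w (suc i)) ≡ true
inFᵇ-w i = trans (cong (eqW (w (suc i)) [] ∨_) found) (∨-zeroʳ _)
  where
  found : anyIdx (λ k → eqW (w (suc i)) (w k)) (suc (length (w (suc i)))) ≡ true
  found = anyIdx-true _ (s≤s z≤n) (s≤s (subst (i ≤_) (sym (length-w (suc i))) (n≤L[1+n] i)))
    (eqW-refl (w (suc i)))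

inFᵇ-≢ : ∀ v → v ≢ [] → (∀ k → v ≢ w (suc k)) → inFᵇ v ≡ false
inFᵇ-≢ v v≢[] v≢w = cong₂ _∨_ (eqW-≢ v [] v≢[])
  (anyIdx-false (λ k → eqW v (w k)) (suc (length v)) λ k → eqW-≢ v (w (suc k)) (v≢w k))

ι-inF : ∀ v → inFᵇ v ≡ true → ι v ≡ v
ι-inF v inF with inFᵇ v
... | true = refl

ι-notInF : ∀ v {u} → inFᵇ v ≡ false → findIdx (ιstep v) (suc (length v)) ≡ just u → ι v ≡ u
ι-notInF v notInF found with inFᵇ v
... | false rewrite found = refl

ιstep-hit : ∀ v i → sprefᵇ (w i) v ≡ true → sprefᵇ v (w (suc i)) ≡ true →
  ιstep v i ≡ just (prefW∞ (length v ∸ 2 * Fm (i ∸ 1)))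
ιstep-hit v i lower upper rewrite lower | upper = refl

ιstep-miss : ∀ v i → prefᵇ (w i) v ≡ false → ιstep v i ≡ nothing
ιstep-miss v i miss rewrite miss = refl

-- ι on lengths

infix 4 _↝_

-- A record rather than a synonym, so that n and n′ can be inferred from a proof.
record _↝_ (n n′ : ℕ) : Set where
  constructor mk↝
  field
    ι-prefW∞ : ι (prefW∞ n) ≡ prefW∞ n′

↝-functional : ∀ {n n₁ n₂} → n ↝ n₁ → n ↝ n₂ → n₁ ≡ n₂
↝-functional (mk↝ ι≡n₁) (mk↝ ι≡n₂) = prefW∞-injective (trans (sym ι≡n₁) ι≡n₂)

↝-L : ∀ i → L (suc i) ↝ L (suc i)
↝-L i = mk↝ (subst (λ v → ι v ≡ v) (sym (prefW∞-L i)) (ι-inF (w (suc i)) (inFᵇ-w i)))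

L-≢-between : ∀ i {n} → L (suc i) < n → n < L (2 + i) → ∀ k → L k ≢ n
L-≢-between i lo hi k refl with ≤-<-connex k (suc i)
... | inj₁ k≤1+i = <-irrefl refl (≤-<-trans (L-mono-≤ k≤1+i) lo)
... | inj₂ 1+i<k = <-irrefl refl (<-≤-trans hi (L-mono-≤ 1+i<k))

↝-between : ∀ i {n} → L (suc i) < n → n < L (2 + i) → n ↝ n ∸ 2 * Fm i
↝-between i {n} lo hi =
  mk↝ (trans (ι-notInF v notInF found) (cong (λ m → prefW∞ (m ∸ 2 * Fm i)) ∣v∣≡n))
  where
  v : Word
  v = prefW∞ n
  ∣v∣≡n : length v ≡ n
  ∣v∣≡n = length-prefW∞ n
  notInF : inFᵇ v ≡ false
  notInF = inFᵇ-≢ v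
    (λ v≡[] → <⇒≢ (≤-<-trans z≤n lo) (trans (cong length (sym v≡[])) ∣v∣≡n))
    (λ k v≡w → L-≢-between i lo hi (suc k)
      (trans (sym (length-w (suc k))) (trans (cong length (sym v≡w)) ∣v∣≡n)))
  w≼v : w (suc i) ≼ v
  w≼v = subst (_≼ v) (prefW∞-L i) (prefW∞-mono (<⇒≤ lo))
  v≼w : v ≼ w (2 + i)
  v≼w = subst (v ≼_) (prefW∞-L (suc i)) (prefW∞-mono (<⇒≤ hi))
  hit : ιstep v (suc i) ≡ just (prefW∞ (length v ∸ 2 * Fm i))
  hit = ιstep-hit v (suc i)
    (sprefᵇ-complete w≼v (subst₂ _<_ (sym (length-w (suc i))) (sym ∣v∣≡n) lo))
    (sprefᵇ-complete v≼w (subst₂ _<_ (sym ∣v∣≡n) (sym (length-w (2 + i))) hi))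
  above : ∀ k → suc i < k → k ≤ suc (length v) → ιstep v k ≡ nothing
  above k 1+i<k _ = ιstep-miss v k (¬-not λ w≼ᵇv → <-irrefl refl (<-≤-trans hi
    (≤-trans (L-mono-≤ 1+i<k) (subst₂ _≤_ (length-w k) ∣v∣≡n (≼-length (prefᵇ-sound (w k) v w≼ᵇv))))))
  found : findIdx (ιstep v) (suc (length v)) ≡ just (prefW∞ (length v ∸ 2 * Fm i))
  found = findIdx-top (ιstep v) (s≤s z≤n)
    (s≤s (subst (i ≤_) (sym ∣v∣≡n) (≤-trans (n≤L[1+n] i) (<⇒≤ lo)))) hit above

↝-gap : ∀ j {r} → 0 < r → r < L (2 + j) → L (3 + j) + r ↝ L j + r
↝-gap j {r} 0<r r<L = subst (L (3 + j) + r ↝_) shift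
  (↝-between (2 + j) (m<m+n (L (3 + j)) 0<r) (+-monoʳ-< (L (3 + j)) r<L))
  where
  regroup : ∀ A B R → A + B + A + R ≡ 2 * A + (B + R)
  regroup = solve-∀
  shift : L (3 + j) + r ∸ 2 * Fm (2 + j) ≡ L j + r
  shift = trans (cong (_∸ 2 * Fm (2 + j)) (regroup (Fm (2 + j)) (Fm (suc j)) r))
    (m+n∸m≡n (2 * Fm (2 + j)) (L j + r))

gap-shrinks : ∀ j r → L j + r < L (3 + j) + r
gap-shrinks j r = +-monoˡ-< r (≤-<-trans (L-mono-≤ (m≤n+m j 2)) (L-<-suc (suc j)))

data Shape : ℕ → Set where
  empty : Shape 0
  fib : ∀ i → Shape (L (suc i))
  gap : ∀ j {r} → 0 < r → r < L (2 + j) → Shape (L (3 + j) + r)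

shape-suc : ∀ {n} → Shape n → Shape (suc n)
shape-suc empty = fib 0
shape-suc (fib zero) = fib 1
shape-suc (fib (suc zero)) = fib 2
shape-suc (fib (suc (suc j))) = subst Shape (+-comm (L (3 + j)) 1) (gap j (s≤s z≤n) (L-≥2 j))
shape-suc (gap j {r} _ r<L) with m≤n⇒m<n∨m≡n r<L
... | inj₁ 1+r<L = subst Shape (+-suc (L (3 + j)) r) (gap j (s≤s z≤n) 1+r<L)
... | inj₂ 1+r≡L =
  subst Shape (trans (cong (L (3 + j) +_) (sym 1+r≡L)) (+-suc (L (3 + j)) r)) (fib (3 + j))

shape : ∀ n → Shape n
shape zero = empty
shape (suc n) = shape-suc (shape n)

infix 4 _⇓_

-- The decrease n′ < n bounds the number of ι-steps by n, the number of iterations α makes.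
data _⇓_ : ℕ → ℕ → Set where
  stop : ∀ {n} → n ↝ n → n ⇓ n
  next : ∀ {n n′ m} → n′ < n → n ↝ n′ → n′ ⇓ m → n ⇓ m

⇓-total : ∀ n → ∃[ m ] n ⇓ m
⇓-total = <-rec _ λ n rec → settle (shape n) rec
  where
  settle : ∀ {n} → Shape n → (∀ {n′} → n′ < n → ∃[ m ] n′ ⇓ m) → ∃[ m ] n ⇓ m
  settle empty _ = 0 , stop (mk↝ refl)
  settle (fib i) _ = L (suc i) , stop (↝-L i)
  settle (gap j {r} 0<r r<L) rec with rec (gap-shrinks j r)
  ... | m , l = m , next (gap-shrinks j r) (↝-gap j 0<r r<L) l

⇓-stop⁻¹ : ∀ {n m} → n ↝ n → n ⇓ m → m ≡ n
⇓-stop⁻¹ _ (stop _) = refl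
⇓-stop⁻¹ n↝n (next n′<n n↝n′ _) = contradiction (↝-functional n↝n n↝n′) (>⇒≢ n′<n)

⇓-gap⁻¹ : ∀ j {r m} → 0 < r → r < L (2 + j) → L (3 + j) + r ⇓ m → L j + r ⇓ m
⇓-gap⁻¹ j {r} 0<r r<L (stop n↝n) =
  contradiction (↝-functional n↝n (↝-gap j 0<r r<L)) (>⇒≢ (gap-shrinks j r))
⇓-gap⁻¹ j 0<r r<L (next _ n↝n′ l) rewrite ↝-functional (↝-gap j 0<r r<L) n↝n′ = l

iterate-suc : ∀ {A : Set} (f : A → A) k x → iterate f (suc k) x ≡ iterate f k (f x)
iterate-suc f zero x = refl
iterate-suc f (suc k) x = cong f (iterate-suc f k x)

iterate-fixed : ∀ {A : Set} (f : A → A) {x} → f x ≡ x → ∀ k → iterate f k x ≡ x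
iterate-fixed f fx≡x zero = refl
iterate-fixed f fx≡x (suc k) = trans (cong f (iterate-fixed f fx≡x k)) fx≡x

⇓-iterate : ∀ {n m k} → n ⇓ m → n ≤ k → iterate ι k (prefW∞ n) ≡ prefW∞ m
⇓-iterate {k = k} (stop (mk↝ ι≡n)) _ = iterate-fixed ι ι≡n k
⇓-iterate {k = zero} (next () _ _) z≤n
⇓-iterate {n} {m} {suc k} (next {n′ = n′} n′<n (mk↝ ι≡n′) l) n≤1+k = begin
  iterate ι (suc k) (prefW∞ n) ≡⟨ iterate-suc ι k _ ⟩
  iterate ι k (ι (prefW∞ n))   ≡⟨ cong (iterate ι k) ι≡n′ ⟩
  iterate ι k (prefW∞ n′)      ≡⟨ ⇓-iterate l (≤-pred (≤-trans n′<n n≤1+k)) ⟩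
  prefW∞ m                     ∎
  where open ≡-Reasoning

α-⇓ : ∀ {n m} → n ⇓ m → α (prefW∞ n) ≡ prefW∞ m
α-⇓ {n} l = trans (cong (λ k → iterate ι k (prefW∞ n)) (length-prefW∞ n)) (⇓-iterate l ≤-refl)

-- Two ι-steps take L (6 + t) ∸ 1 to L (3 + t) ∸ 1.
⇓-from-L∸1 : ∀ J {m} → L J ∸ 1 ⇓ m → m ≤ 3
⇓-from-L∸1 0 l rewrite ⇓-stop⁻¹ (mk↝ refl) l = z≤n
⇓-from-L∸1 1 l rewrite ⇓-stop⁻¹ (mk↝ refl) l = z≤n
⇓-from-L∸1 2 l rewrite ⇓-stop⁻¹ (↝-L 0) l = s≤s z≤n
⇓-from-L∸1 3 l rewrite ⇓-stop⁻¹ (↝-L 1) l = s≤s (s≤s z≤n)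
⇓-from-L∸1 4 l rewrite ⇓-stop⁻¹ (↝-L 1) (⇓-gap⁻¹ 0 {1} (s≤s z≤n) ≤-refl l) = s≤s (s≤s z≤n)
⇓-from-L∸1 5 l rewrite ⇓-stop⁻¹ (↝-L 2) (⇓-gap⁻¹ 1 {2} (s≤s z≤n) ≤-refl l) = ≤-refl
⇓-from-L∸1 (suc (suc (suc (suc (suc (suc t)))))) {m} l =
  ⇓-from-L∸1 (suc (suc (suc t))) (subst (_⇓ m) e₂ l₂)
  where
  r₁ r₂ : ℕ
  r₁ = L (4 + t) ∸ 1
  r₂ = L (2 + t) ∸ 1
  e₀ : L (6 + t) ∸ 1 ≡ L (5 + t) + r₁
  e₀ = +-∸-assoc (L (5 + t)) (L-pos (4 + t))
  e₁ : L (2 + t) + r₁ ≡ L (4 + t) + r₂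
  e₁ = begin
    L (2 + t) + (L (4 + t) ∸ 1) ≡⟨ +-∸-assoc (L (2 + t)) (L-pos (4 + t)) ⟨
    L (2 + t) + L (4 + t) ∸ 1   ≡⟨ cong (_∸ 1) (+-comm (L (2 + t)) (L (4 + t))) ⟩
    L (4 + t) + L (2 + t) ∸ 1   ≡⟨ +-∸-assoc (L (4 + t)) (L-pos (2 + t)) ⟩
    L (4 + t) + (L (2 + t) ∸ 1) ∎
    where open ≡-Reasoning
  e₂ : L (1 + t) + r₂ ≡ L (3 + t) ∸ 1
  e₂ = trans (sym (+-∸-assoc (L (1 + t)) (L-pos (2 + t))))
    (cong (_∸ 1) (+-comm (L (1 + t)) (L (2 + t))))
  l₁ : L (2 + t) + r₁ ⇓ m
  l₁ = ⇓-gap⁻¹ (2 + t) (0<L∸1 (2 + t)) (L∸1<L (4 + t)) (subst (_⇓ m) e₀ l)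
  l₂ : L (1 + t) + r₂ ⇓ m
  l₂ = ⇓-gap⁻¹ (1 + t) (0<L∸1 t) (≤-trans (L∸1<L (2 + t)) (L-≤-suc (2 + t)))
    (subst (_⇓ m) e₁ l₁)

-- θ on lengths

isA : E → ℕ
isA a = 1
isA b = 0

countA : Word → ℕ
countA [] = 0
countA (c ∷ u) = isA c + countA u

countA-++ : ∀ u v → countA (u ++ v) ≡ countA u + countA v
countA-++ [] v = refl
countA-++ (c ∷ u) v = trans (cong (isA c +_) (countA-++ u v)) (sym (+-assoc (isA c) _ _))

countA-≼ : ∀ {u v} → u ≼ v → countA u ≤ countA v
countA-≼ {u} (s , refl) = subst (countA u ≤_) (sym (countA-++ u s)) (m≤m+n _ _)

countA-w : ∀ k → countA (w k) ≡ Fm k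
countA-w zero = refl
countA-w (suc zero) = refl
countA-w (suc (suc k)) = trans (countA-++ (w (suc k)) (w k)) (cong₂ _+_ (countA-w (suc k)) (countA-w k))

length-θ : ∀ u → length (θ u) ≡ length u + countA u
length-θ [] = refl
length-θ (a ∷ u) = cong suc (trans (cong suc (length-θ u)) (sym (+-suc (length u) (countA u))))
length-θ (b ∷ u) = cong suc (length-θ u)

countA-swap : ∀ c d u → countA (c ∷ d ∷ u) ≡ countA (d ∷ c ∷ u)
countA-swap a a u = refl
countA-swap a b u = refl
countA-swap b a u = refl
countA-swap b b u = refl

countA-take-swap : ∀ x c d z m → m ≢ suc (length x) →
  countA (take m (x ++ c ∷ d ∷ z)) ≡ countA (take m (x ++ d ∷ c ∷ z))
countA-take-swap [] c d z zero _ = refl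
countA-take-swap [] c d z (suc zero) m≢1 = contradiction refl m≢1
countA-take-swap [] c d z (suc (suc m)) _ = countA-swap c d (take m z)
countA-take-swap (y ∷ x) c d z zero _ = refl
countA-take-swap (y ∷ x) c d z (suc m) 1+m≢ =
  cong (isA y +_) (countA-take-swap x c d z m (1+m≢ ∘ cong suc))

countA-take-w-swap : ∀ k z m → suc m ≢ L k + L (suc k) →
  countA (take m (w (suc k) ++ w k ++ z)) ≡ countA (take m (w k ++ w (suc k) ++ z))
countA-take-w-swap k z m 1+m≢ with w-swap k
... | x , c , d , w·w′ , w′·w = begin
  countA (take m (w (suc k) ++ w k ++ z)) ≡⟨ cong (countA ∘ take m) (regroup (w (suc k)) (w k) w′·w) ⟩
  countA (take m (x ++ d ∷ c ∷ z))        ≡⟨ countA-take-swap x d c z m m≢ ⟩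
  countA (take m (x ++ c ∷ d ∷ z))        ≡⟨ cong (countA ∘ take m) (regroup (w k) (w (suc k)) w·w′) ⟨
  countA (take m (w k ++ w (suc k) ++ z)) ∎
  where
  open ≡-Reasoning
  regroup : ∀ u v {e f} → u ++ v ≡ x ++ e ∷ f ∷ [] → u ++ v ++ z ≡ x ++ e ∷ f ∷ z
  regroup u v {e} {f} eq =
    trans (sym (++-assoc u v z)) (trans (cong (_++ z) eq) (++-assoc x (e ∷ f ∷ []) z))
  m≢ : m ≢ suc (length x)
  m≢ refl = 1+m≢ (sym (begin
    L k + L (suc k)                     ≡⟨ cong₂ _+_ (length-w k) (length-w (suc k)) ⟨
    length (w k) + length (w (suc k))   ≡⟨ length-++ (w k) ⟨
    length (w k ++ w (suc k))           ≡⟨ cong length w·w′ ⟩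
    length (x ++ c ∷ d ∷ [])            ≡⟨ length-++ x ⟩
    length x + 2                        ≡⟨ +-comm (length x) 2 ⟩
    suc (suc (length x))                ∎))

-- The prefix of length L k + r of w (2 + k) w k ≼ w∞ and that of w k w (2 + k)
-- differ by a transposition of adjacent letters, at position L k + L (k + 1) - 1.
countA-prefW∞-+ : ∀ k {r} → r < L (2 + k) → suc r ≢ L (suc k) →
  countA (prefW∞ (L k + r)) ≡ Fm k + countA (prefW∞ r)
countA-prefW∞-+ zero {zero} _ 1≢1 = contradiction refl 1≢1
countA-prefW∞-+ zero {suc zero} _ _ = refl
countA-prefW∞-+ zero {suc (suc r)} (s≤s (s≤s ())) _
countA-prefW∞-+ (suc k) {r} r<L 1+r≢L = begin
  countA (prefW∞ m)                            ≡⟨ cong countA prefix-long ⟩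
  countA (take m (w (suc k′) ++ w k′ ++ w k′)) ≡⟨ countA-take-w-swap k′ (w k′) m 1+m≢ ⟩
  countA (take m (w k′ ++ w (2 + k′)))         ≡⟨ cong countA prefix-short ⟩
  countA (w k′ ++ prefW∞ r)                    ≡⟨ countA-++ (w k′) _ ⟩
  countA (w k′) + countA (prefW∞ r)            ≡⟨ cong (_+ countA (prefW∞ r)) (countA-w k′) ⟩
  Fm k′ + countA (prefW∞ r)                    ∎
  where
  open ≡-Reasoning
  k′ m : ℕ
  k′ = suc k
  m = L k′ + r
  m≤ : m ≤ length (w (2 + k′) ++ w k′)
  m≤ = subst (m ≤_)
    (sym (trans (length-++ (w (2 + k′))) (cong₂ _+_ (length-w (2 + k′)) (length-w k′))))
    (subst (m ≤_) (+-comm (L k′) (L (2 + k′))) (+-monoʳ-≤ (L k′) (<⇒≤ r<L)))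
  prefix-long : prefW∞ m ≡ take m (w (suc k′) ++ w k′ ++ w k′)
  prefix-long = trans (prefW∞-take-≼ (2 + k′ , ≼-++ˡ (w (2 + k′)) (w-≼-suc k)) m≤)
    (cong (take m) (++-assoc (w (suc k′)) (w k′) (w k′)))
  prefix-short : take m (w k′ ++ w (2 + k′)) ≡ w k′ ++ prefW∞ r
  prefix-short = begin
    take (L k′ + r) (w k′ ++ w (2 + k′))
      ≡⟨ cong (λ l → take (l + r) (w k′ ++ w (2 + k′))) (length-w k′) ⟨
    take (length (w k′) + r) (w k′ ++ w (2 + k′))   ≡⟨ take-length-++ (w k′) r _ ⟩
    w k′ ++ take r (w (2 + k′))                     ≡⟨ cong (w k′ ++_) (prefW∞-take (suc k′) (<⇒≤ r<L)) ⟨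
    w k′ ++ prefW∞ r                                ∎
  1+m≢ : suc m ≢ L k′ + L (suc k′)
  1+m≢ eq = 1+r≢L (+-cancelˡ-≡ (L k′) _ _ (trans (+-suc (L k′) r) eq))

Θ : ℕ → ℕ
Θ n = length (θ (prefW∞ n))

θ-prefW∞ : ∀ n → θ (prefW∞ n) ≡ prefW∞ (Θ n)
θ-prefW∞ n = isPref⇒≡prefW∞ (θ-isPref (prefW∞-isPref n))

Θ≡+countA : ∀ n → Θ n ≡ n + countA (prefW∞ n)
Θ≡+countA n = trans (length-θ (prefW∞ n)) (cong (_+ countA (prefW∞ n)) (length-prefW∞ n))

Θ-L : ∀ i → Θ (L (suc i)) ≡ L (2 + i)
Θ-L i = begin
  length (θ (prefW∞ (L (suc i)))) ≡⟨ cong (length ∘ θ) (prefW∞-L i) ⟩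
  length (θ (w (suc i)))          ≡⟨ cong length (θ-w (suc i)) ⟩
  length (w (2 + i))              ≡⟨ length-w (2 + i) ⟩
  L (2 + i)                       ∎
  where open ≡-Reasoning

Θ-mono-< : ∀ {m n} → m < n → Θ m < Θ n
Θ-mono-< {m} {n} m<n = subst₂ _<_ (sym (Θ≡+countA m)) (sym (Θ≡+countA n))
  (+-mono-<-≤ m<n (countA-≼ (prefW∞-mono (<⇒≤ m<n))))

Θ-+ : ∀ k {r} → r < L (2 + k) → suc r ≢ L (suc k) → Θ (L k + r) ≡ L (suc k) + Θ r
Θ-+ k {r} r<L 1+r≢L = begin
  Θ (L k + r)                                  ≡⟨ Θ≡+countA (L k + r) ⟩
  L k + r + countA (prefW∞ (L k + r))          ≡⟨ cong (L k + r +_) (countA-prefW∞-+ k r<L 1+r≢L) ⟩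
  L k + r + (Fm k + countA (prefW∞ r))         ≡⟨ regroup (L k) (Fm k) r (countA (prefW∞ r)) ⟩
  L k + Fm k + (r + countA (prefW∞ r))         ≡⟨ cong (L (suc k) +_) (Θ≡+countA r) ⟨
  L (suc k) + Θ r                              ∎
  where
  open ≡-Reasoning
  regroup : ∀ A B R C → A + R + (B + C) ≡ A + B + (R + C)
  regroup = solve-∀

Θ-↝-gap : ∀ j {r} → 0 < r → r < L (2 + j) → suc r ≢ L (suc j) →
  Θ (L (3 + j) + r) ↝ Θ (L j + r)
Θ-↝-gap j {r} 0<r r<L 1+r≢L = subst₂ _↝_ (sym Θ-long) (sym Θ-short) (↝-gap (suc j) 0<Θr Θr<L)
  where
  L[2+j]<L[4+j] : L (2 + j) < L (4 + j)
  L[2+j]<L[4+j] = <-≤-trans (L-<-suc (suc j)) (L-≤-suc (3 + j))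
  Θ-long : Θ (L (3 + j) + r) ≡ L (4 + j) + Θ r
  Θ-long = Θ-+ (3 + j) (<-≤-trans r<L (L-mono-≤ (m≤n+m (2 + j) 3)))
    (<⇒≢ (≤-<-trans r<L L[2+j]<L[4+j]))
  Θ-short : Θ (L j + r) ≡ L (suc j) + Θ r
  Θ-short = Θ-+ j r<L 1+r≢L
  0<Θr : 0 < Θ r
  0<Θr = Θ-mono-< 0<r
  Θr<L : Θ r < L (3 + j)
  Θr<L = subst (Θ r <_) (Θ-L (suc j)) (Θ-mono-< r<L)

Θ-⇓ : ∀ {n m} → n ⇓ m → 3 < m → Θ n ⇓ Θ m
Θ-⇓ {n} (stop n↝n) _ with shape n
... | empty = stop (mk↝ refl)
... | fib i = subst (λ k → k ⇓ k) (sym (Θ-L i)) (stop (↝-L (suc i)))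
... | gap j 0<r r<L = contradiction (↝-functional n↝n (↝-gap j 0<r r<L)) (>⇒≢ (gap-shrinks j _))
Θ-⇓ {n} {m} (next n′<n n↝n′ l) 3<m with shape n
... | empty = contradiction n′<n λ ()
... | fib i = contradiction (↝-functional (↝-L i) n↝n′) (>⇒≢ n′<n)
... | gap j {r} 0<r r<L with ↝-functional (↝-gap j 0<r r<L) n↝n′
...   | refl with suc r ≟ L (suc j)
...     | yes 1+r≡L =
  contradiction (⇓-from-L∸1 (2 + j) (subst (_⇓ m) (sym exceptional) l)) (<⇒≱ 3<m)
  where
  exceptional : L (2 + j) ∸ 1 ≡ L j + r
  exceptional = trans (cong (λ x → x + L j ∸ 1) (sym 1+r≡L)) (+-comm r (L j))
...     | no 1+r≢L = next (Θ-mono-< (gap-shrinks j r)) (Θ-↝-gap j 0<r r<L 1+r≢L) (Θ-⇓ l 3<m)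

corollary5p8 : (v : Word) → 𝓥 4 v → α (θ v) ≡ θ (α v)
corollary5p8 v (v-pref , w₄≼αv) with ⇓-total (length v)
... | m , l = begin
  α (θ v)                      ≡⟨ cong (α ∘ θ) v≡ ⟩
  α (θ (prefW∞ (length v)))    ≡⟨ cong α (θ-prefW∞ (length v)) ⟩
  α (prefW∞ (Θ (length v)))    ≡⟨ α-⇓ (Θ-⇓ l 3<m) ⟩
  prefW∞ (Θ m)                 ≡⟨ θ-prefW∞ m ⟨
  θ (prefW∞ m)                 ≡⟨ cong θ αv≡ ⟨
  θ (α v)                      ∎
  where
  open ≡-Reasoning
  v≡ : v ≡ prefW∞ (length v)
  v≡ = isPref⇒≡prefW∞ v-pref
  αv≡ : α v ≡ prefW∞ m
  αv≡ = trans (cong α v≡) (α-⇓ l)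
  3<m : 3 < m
  3<m = <⇒≤ (subst (5 ≤_) (trans (cong length αv≡) (length-prefW∞ m)) (≼-length w₄≼αv))
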